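{- Let $m>1$ and $a$ be positive integers with $a<\sqrt{m}$. Let $V=\sqrt{\frac{m-a^2}{3a+2}}$ and $U=\sqrt{(m-a^2)(3a+2)}$. Let $(a,b,c)$ be an $m$-Markoff triple such that either $(a,b,c)$ or $(b,a,c)$ is minimal, and suppose that either $b=V$ or $c-3ab=V$. Then $c=3ab+b$ and $(c,b)$ is a fundamental solution of $x^2-3axy+y^2=m-a^2$.
   Context: An $m$-Markoff triple is a triple $(a,b,c)$ of positive integers with $a^2+b^2+c^2=3abc+m$. A minimal triple is an $m$-Markoff triple $(x,y,z)$ with $x\le y\le z$ and $3xy-z\le 0$. Let $F(x,y)=x^2-3axy+y^2$. The integer solutions of $F(x,y)=m-a^2$ are partitioned into equivalence classes under the automorphs $\pm T^k$ ($k\in\mathbb{Z}$) of $F$, where $T(x,y)=(3ax-y,x)$; each class contains a unique fundamental solution. Concretely, an integer solution $(u,v)$ with $v\ge 0$ is fundamental if and only if one of the following holds: (1) $0<v<V$; (2) $v=0$ and $u=\sqrt{m-a^2}$; (3) $v=V$ and $u=(U+3aV)/2$. -}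

module Defs where

open import Data.Nat as ℕ using (ℕ)
open import Data.Integer using (ℤ; +_; _+_; _-_; _*_; _≤_; _<_; 0ℤ)
open import Data.Product using (_×_)
open import Data.Sum using (_⊎_)
open import Relation.Binary.PropositionalEquality using (_≡_)

IsMarkoffTriple : ℕ → ℕ → ℕ → ℕ → Set
IsMarkoffTriple m a b c =
  (0 ℕ.< a) × (0 ℕ.< b) × (0 ℕ.< c) ×
  (a ℕ.* a ℕ.+ b ℕ.* b ℕ.+ c ℕ.* c ≡ 3 ℕ.* a ℕ.* b ℕ.* c ℕ.+ m)

IsMinimal : ℕ → ℕ → ℕ → ℕ → Set
IsMinimal m x y z =
  IsMarkoffTriple m x y z × (x ℕ.≤ y) × (y ℕ.≤ z) × (3 ℕ.* x ℕ.* y ℕ.≤ z)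

F : ℤ → ℤ → ℤ → ℤ
F a x y = x * x - + 3 * a * x * y + y * y

N : ℕ → ℕ → ℤ
N m a = + m - + a * + a

-- "v = V" where V = sqrt((m-a²)/(3a+2)) (a nonnegative real):
-- v is the nonnegative integer with v²(3a+2) = m - a².
IsV : ℕ → ℕ → ℤ → Set
IsV m a v = (0ℤ ≤ v) × (v * v * (+ 3 * + a + + 2) ≡ N m a)

-- "0 < v < V": 0 < v and v²(3a+2) < m - a² (equivalent since V ≥ 0).
BelowV : ℕ → ℕ → ℤ → Set
BelowV m a v = (0ℤ < v) × (v * v * (+ 3 * + a + + 2) < N m a)

IsU : ℕ → ℕ → ℤ → Set
IsU m a w = (0ℤ ≤ w) × (w * w ≡ N m a * (+ 3 * + a + + 2))

IsSqrtN : ℕ → ℕ → ℤ → Set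
IsSqrtN m a u = (0ℤ ≤ u) × (u * u ≡ N m a)

-- Fundamental solution of F(x,y) = m - a² (with v ≥ 0), per the context:
-- (1) 0 < v < V; (2) v = 0 and u = sqrt(m-a²); (3) v = V and u = (U+3aV)/2,
-- the last written as 2u - 3aV = U.
IsFundamental : ℕ → ℕ → ℤ → ℤ → Set
IsFundamental m a u v =
  (F (+ a) u v ≡ N m a) × (0ℤ ≤ v) ×
  ( BelowV m a v
  ⊎ (v ≡ 0ℤ × IsSqrtN m a u)
  ⊎ (IsV m a v × IsU m a (+ 2 * u - + 3 * + a * v)))

{-# OPTIONS --safe #-}
module Submission where

-- Write n = m - a². The Markoff equation reads c(c - 3ab) = n - b², which
-- already gives F(c, b) = n. If b = V, i.e. b²(3a + 2) = n, it factors as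
-- (c - 3ab - b)(c + b) = 0; if d = c - 3ab = V, it factors as
-- (d - b)(3ad + d + b) = 0. The second factor is positive in both cases, so
-- c = 3ab + b and b = V, and then 2c - 3ab = b(3a + 2) = U: (c, b) is a
-- fundamental solution of the third kind.

module MarkoffQuadraticForm where

  import Data.Nat as ℕ
  import Data.Nat.Properties as ℕ
  open import Data.Integer
    using (ℤ; +_; 0ℤ; _+_; _-_; _*_; _≤_; _<_; +≤+; +<+; >-nonZero)
  open import Data.Integer.Properties using (pos-*; i-j≡0⇒i≡j; *-cancelʳ-≡)
  open import Data.Integer.Tactic.RingSolver using (solve)
  open import Data.List using (_∷_; [])
  open import Data.Product using (_,_)
  open import Data.Sum using (inj₂)
  open import Relation.Binary.PropositionalEquality
    using (_≡_; sym; trans; cong; cong₂; subst; module ≡-Reasoning)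
  open import Defs
  open ≡-Reasoning

  pos-3*a*b : ∀ a b → + (3 ℕ.* a ℕ.* b) ≡ + 3 * + a * + b
  pos-3*a*b a b = trans (pos-* (3 ℕ.* a) b) (cong (_* + b) (pos-* 3 a))

  markoff-ℤ : ∀ m a b c →
    a ℕ.* a ℕ.+ b ℕ.* b ℕ.+ c ℕ.* c ≡ 3 ℕ.* a ℕ.* b ℕ.* c ℕ.+ m →
    + a * + a + + b * + b + + c * + c ≡ + 3 * + a * + b * + c + + m
  markoff-ℤ m a b c eq = begin
    + a * + a + + b * + b + + c * + c
      ≡⟨ sym (cong₂ _+_ (cong₂ _+_ (pos-* a a) (pos-* b b)) (pos-* c c)) ⟩
    + (a ℕ.* a ℕ.+ b ℕ.* b ℕ.+ c ℕ.* c)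
      ≡⟨ cong +_ eq ⟩
    + (3 ℕ.* a ℕ.* b ℕ.* c) + + m
      ≡⟨ cong (_+ + m) (trans (pos-* (3 ℕ.* a ℕ.* b) c) (cong (_* + c) (pos-3*a*b a b))) ⟩
    + 3 * + a * + b * + c + + m
      ∎

  markoff⇒vieta : ∀ m a b c →
    a * a + b * b + c * c ≡ + 3 * a * b * c + m →
    c * (c - + 3 * a * b) ≡ m - a * a - b * b
  markoff⇒vieta m a b c eq = begin
    c * (c - + 3 * a * b)
      ≡⟨ solve (a ∷ b ∷ c ∷ []) ⟩
    (a * a + b * b + c * c) - a * a - b * b - + 3 * a * b * c
      ≡⟨ cong (λ l → l - a * a - b * b - + 3 * a * b * c) eq ⟩
    (+ 3 * a * b * c + m) - a * a - b * b - + 3 * a * b * c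
      ≡⟨ solve (m ∷ a ∷ b ∷ c ∷ []) ⟩
    m - a * a - b * b
      ∎

  factor-vanishes : ∀ i {j} → 0ℤ < j → i * j ≡ 0ℤ → i ≡ 0ℤ
  factor-vanishes i {j} 0<j ij≡0 = *-cancelʳ-≡ i 0ℤ j {{>-nonZero 0<j}} ij≡0

  module Vieta (n a b c : ℤ) (vieta : c * (c - + 3 * a * b) ≡ n - b * b) where

    F≡n : F a c b ≡ n
    F≡n = begin
      F a c b                          ≡⟨⟩
      c * c - + 3 * a * c * b + b * b  ≡⟨ solve (a ∷ b ∷ c ∷ []) ⟩
      c * (c - + 3 * a * b) + b * b    ≡⟨ cong (_+ b * b) vieta ⟩
      n - b * b + b * b                ≡⟨ solve (n ∷ b ∷ []) ⟩
      n                                ∎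

    b≡V⇒c≡3ab+b : 0ℤ < c + b → b * b * (+ 3 * a + + 2) ≡ n → c ≡ + 3 * a * b + b
    b≡V⇒c≡3ab+b 0<c+b b≡V =
      i-j≡0⇒i≡j c _ (factor-vanishes (c - (+ 3 * a * b + b)) 0<c+b product≡0)
      where
      product≡0 : (c - (+ 3 * a * b + b)) * (c + b) ≡ 0ℤ
      product≡0 = begin
        (c - (+ 3 * a * b + b)) * (c + b)
          ≡⟨ solve (a ∷ b ∷ c ∷ []) ⟩
        c * (c - + 3 * a * b) + b * b - b * b * (+ 3 * a + + 2)
          ≡⟨ cong₂ (λ x y → x + b * b - y) vieta b≡V ⟩
        n - b * b + b * b - n
          ≡⟨ solve (n ∷ b ∷ []) ⟩
        0ℤ
          ∎

    d≡V⇒d≡b : let d = c - + 3 * a * b in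
      0ℤ < + 3 * a * d + d + b → d * d * (+ 3 * a + + 2) ≡ n → d ≡ b
    d≡V⇒d≡b 0<3ad+d+b d≡V =
      i-j≡0⇒i≡j _ b (factor-vanishes _ 0<3ad+d+b product≡0)
      where
      product≡0 : let d = c - + 3 * a * b in (d - b) * (+ 3 * a * d + d + b) ≡ 0ℤ
      product≡0 = let d = c - + 3 * a * b in begin
        (d - b) * (+ 3 * a * d + d + b)
          ≡⟨ solve (a ∷ b ∷ c ∷ []) ⟩
        d * d * (+ 3 * a + + 2) - (c * d + b * b)
          ≡⟨ cong₂ (λ x y → x - (y + b * b)) d≡V vieta ⟩
        n - (n - b * b + b * b)
          ≡⟨ solve (n ∷ b ∷ []) ⟩
        0ℤ
          ∎

  d≡b⇒c≡3ab+b : ∀ a b c → c - + 3 * a * b ≡ b → c ≡ + 3 * a * b + b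
  d≡b⇒c≡3ab+b a b c d≡b = begin
    c                                ≡⟨ solve (a ∷ b ∷ c ∷ []) ⟩
    + 3 * a * b + (c - + 3 * a * b)  ≡⟨ cong (_+_ (+ 3 * a * b)) d≡b ⟩
    + 3 * a * b + b                  ∎

  0<3ad+d+b : ∀ a {d b} → 0ℤ ≤ d → 0 ℕ.< b → 0ℤ < + 3 * + a * d + d + + b
  0<3ad+d+b a {b = b} (+≤+ {n = k} _) 0<b =
    subst (λ t → 0ℤ < t + + k + + b) (pos-3*a*b a k)
      (+<+ (ℕ.<-≤-trans 0<b (ℕ.m≤n+m b _)))

  IsV⇒IsU : ∀ {m a v} → IsV m a v → IsU m a (v * (+ 3 * + a + + 2))
  IsV⇒IsU {m} {a} {v} (0≤v , v²w≡n) = 0≤vw 0≤v , vw²≡nw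
    where
    w = + 3 * + a + + 2
    0≤vw : ∀ {v} → 0ℤ ≤ v → 0ℤ ≤ v * w
    0≤vw (+≤+ {n = k} _) =
      subst (λ t → 0ℤ ≤ + k * (t + + 2)) (pos-* 3 a)
        (subst (0ℤ ≤_) (pos-* k _) (+≤+ ℕ.z≤n))
    regroup : ∀ v w → v * w * (v * w) ≡ v * v * w * w
    regroup v w = solve (v ∷ w ∷ [])
    vw²≡nw : v * w * (v * w) ≡ N m a * w
    vw²≡nw = trans (regroup v w) (cong (_* w) v²w≡n)

  v≡V⇒fundamental : ∀ {m a u v} → F (+ a) u v ≡ N m a → IsV m a v →
    u ≡ + 3 * + a * v + v → IsFundamental m a u v
  v≡V⇒fundamental {m} {a} {u} {v} F≡n v≡V@(0≤v , _) u≡3av+v =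
    F≡n , 0≤v , inj₂ (inj₂ (v≡V , subst (IsU m a) (sym 2u-3av≡vw) (IsV⇒IsU {m} {a} v≡V)))
    where
    twice-minus : ∀ a v → + 2 * (+ 3 * a * v + v) - + 3 * a * v ≡ v * (+ 3 * a + + 2)
    twice-minus a v = solve (a ∷ v ∷ [])
    2u-3av≡vw : + 2 * u - + 3 * + a * v ≡ v * (+ 3 * + a + + 2)
    2u-3av≡vw = trans (cong (λ x → + 2 * x - + 3 * + a * v) u≡3av+v) (twice-minus (+ a) v)

open MarkoffQuadraticForm
open import Defs
open import Data.Nat using (ℕ; _<_; _*_; _+_)
open import Data.Integer using (+_; _-_)
open import Data.Product using (_×_; _,_; proj₁; proj₂)
open import Data.Sum using (_⊎_; [_,_]′)
open import Relation.Binary.PropositionalEquality using (_≡_; sym; trans; cong; subst)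
open import Function using (_∘_)
import Data.Nat.Properties as ℕ
import Data.Integer as ℤ
import Data.Integer.Properties as ℤ

corollary3p1 : (m a b c : ℕ) → 1 < m → 0 < a → a * a < m →
    IsMarkoffTriple m a b c →
    (IsMinimal m a b c ⊎ IsMinimal m b a c) →
    (IsV m a (+ b) ⊎ IsV m a (+ c - + (3 * a * b))) →
    (c ≡ 3 * a * b + b) × IsFundamental m a (+ c) (+ b)
corollary3p1 m a b c _ _ _ (_ , 0<b , 0<c , markoff) _ b-or-d≡V =
  c≡3ab+b , v≡V⇒fundamental {m} {a} F≡n b≡V c≡3ab+bℤ
  where
  open Vieta (N m a) (+ a) (+ b) (+ c)
    (markoff⇒vieta (+ m) (+ a) (+ b) (+ c) (markoff-ℤ m a b c markoff))
  B≡V∧C≡3AB+B : Set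
  B≡V∧C≡3AB+B = IsV m a (+ b) × (+ c ≡ + 3 ℤ.* + a ℤ.* + b ℤ.+ + b)
  from-b≡V : IsV m a (+ b) → B≡V∧C≡3AB+B
  from-b≡V b≡V@(_ , b²w≡n) =
    b≡V , b≡V⇒c≡3ab+b (ℤ.+<+ (ℕ.<-≤-trans 0<c (ℕ.m≤m+n c b))) b²w≡n
  from-d≡V : IsV m a (+ c - + 3 ℤ.* + a ℤ.* + b) → B≡V∧C≡3AB+B
  from-d≡V d≡V@(0≤d , d²w≡n) = subst (IsV m a) d≡b d≡V , d≡b⇒c≡3ab+b (+ a) (+ b) (+ c) d≡b
    where
    d≡b : + c - + 3 ℤ.* + a ℤ.* + b ≡ + b
    d≡b = d≡V⇒d≡b (0<3ad+d+b a 0≤d 0<b) d²w≡n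
  b≡V∧c≡3ab+b : B≡V∧C≡3AB+B
  b≡V∧c≡3ab+b = [ from-b≡V , from-d≡V ∘ subst (λ t → IsV m a (+ c - t)) (pos-3*a*b a b) ]′ b-or-d≡V
  b≡V : IsV m a (+ b)
  b≡V = proj₁ b≡V∧c≡3ab+b
  c≡3ab+bℤ : + c ≡ + 3 ℤ.* + a ℤ.* + b ℤ.+ + b
  c≡3ab+bℤ = proj₂ b≡V∧c≡3ab+b
  c≡3ab+b : c ≡ 3 * a * b + b
  c≡3ab+b = ℤ.+-injective (trans c≡3ab+bℤ (cong (ℤ._+ + b) (sym (pos-3*a*b a b))))
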